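{- For $0\le k\le n$, \[ CR(n,k)=\sum_{i=0}^{k}\binom{k}{i}R_{n-i}=\sum_{i=0}^{n-k}(-1)^i\binom{n-k}{i}C_{n-i}. \] In particular $C_n=\sum_{i=0}^n\binom{n}{i}R_i$ and $R_n=\sum_{i=0}^n(-1)^i\binom{n}{i}C_{n-i}$.
   Context: For $0\le k\le n$, $\mathcal{CR}(n,k)$ is the set of lattice paths from $(0,0)$ to $(n+k,0)$ such that (1) the first $2k$ steps lie in $\{(1,1),(1,-1)\}$; (2) the last $n-k$ steps lie in $\{(1,2),(1,0),(1,-2)\}$, with no step $(1,0)$ on the $x$-axis; (3) the path never goes below the $x$-axis; $CR(n,k)=|\mathcal{CR}(n,k)|$. $C_n=\frac{1}{n+1}\binom{2n}{n}$ is the Catalan number. $R_n$ (Riordan number) is the number of lattice paths from $(0,0)$ to $(n,0)$ with steps in $\{(1,1),(1,0),(1,-1)\}$, never going below the $x$-axis, with no step $(1,0)$ on the $x$-axis. -}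

module Defs where

open import Data.Nat using (ℕ; zero; suc; _+_; _*_; _∸_)
open import Data.Nat.Combinatorics using (_C_)
open import Data.Nat.DivMod using (_/_)
open import Data.Integer as ℤ using (ℤ; +_)
open import Data.List using (List; []; _∷_; _++_; map; concatMap; filter; length; upTo; foldr)
open import Data.Maybe using (Maybe; just; nothing)
open import Data.Maybe.Properties using (≡-dec)
open import Data.Nat.Properties using (_≟_)
open import Relation.Binary.PropositionalEquality using (_≡_)
open import Relation.Nullary using (Dec)

-- Lattice-path steps (all have x-increment 1):
--   up1 = (1,1), down1 = (1,-1), up2 = (1,2), flat = (1,0), down2 = (1,-2)
data Step : Set where
  up1 down1 up2 flat down2 : Step

walk : ℕ → List Step → Maybe ℕ
walk h [] = just h
walk h (up1 ∷ s) = walk (suc h) s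
walk h (up2 ∷ s) = walk (suc (suc h)) s
walk zero (down1 ∷ s) = nothing
walk (suc h) (down1 ∷ s) = walk h s
walk zero (down2 ∷ s) = nothing
walk (suc zero) (down2 ∷ s) = nothing
walk (suc (suc h)) (down2 ∷ s) = walk h s
walk zero (flat ∷ s) = nothing
walk (suc h) (flat ∷ s) = walk (suc h) s

Admissible : List Step → Set
Admissible s = walk 0 s ≡ just 0

admissible? : (s : List Step) → Dec (Admissible s)
admissible? s = ≡-dec _≟_ (walk 0 s) (just 0)

words : List Step → ℕ → List (List Step)
words A zero = [] ∷ []
words A (suc m) = concatMap (λ a → map (a ∷_) (words A m)) A

crCandidates : ℕ → ℕ → List (List Step)
crCandidates n k =
  concatMap (λ p → map (p ++_) (words (up2 ∷ flat ∷ down2 ∷ []) (n ∸ k)))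
            (words (up1 ∷ down1 ∷ []) (2 * k))

CR : ℕ → ℕ → ℕ
CR n k = length (filter admissible? (crCandidates n k))

R : ℕ → ℕ
R n = length (filter admissible? (words (up1 ∷ flat ∷ down1 ∷ []) n))

Cat : ℕ → ℕ
Cat n = ((2 * n) C n) / suc n

Σℕ : ℕ → (ℕ → ℕ) → ℕ
Σℕ m f = foldr _+_ 0 (map f (upTo (suc m)))

Σℤ : ℕ → (ℕ → ℤ) → ℤ
Σℤ m f = foldr ℤ._+_ (+ 0) (map f (upTo (suc m)))

sgn : ℕ → ℤ
sgn zero = + 1
sgn (suc i) = ℤ.- sgn i

-- Counting admissible paths by their final height turns a set of steps into a
-- linear operator on weights T : ℕ → ℕ, namely T ↦ (h ↦ Σ T(h + s)) over the steps s
-- allowed at height h.  Let U, B, M be the operators of the steps {±1},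
-- {±2, 0 off the axis} and {±1, 0 off the axis}, and δ the indicator of 0.  Then
-- CR(n,k) = (U^{2k} B^{n-k} δ)(0) and R_n = (M^n δ)(0) = (B^n δ)(0), since B acts on
-- even heights as M does on all heights; and C_n = (U^{2n} δ)(0) by the ballot formula.
-- The key identity is U² = B + 1: two ±1 steps move by ±2 or come back, and they can
-- come back in two ways except on the axis, where the flat step is forbidden.  Hence
-- X(k,m) = (U^{2k} B^m δ)(0) satisfies X(k+1,m) = X(k,m+1) + X(k,m), and an array with
-- this Pascal recurrence is the binomial transform of its first row and the
-- alternating binomial transform of its first column.
module Submission where

open import Defs

module BinomialSums where
  open import Algebra.Properties.CommutativeSemigroup using (interchange; x∙yz≈xz∙y)
  open import Data.Integer using (ℤ; +_; _+_; _*_; -_; _-_)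
  open import Data.Integer.Properties
    using (+-identityʳ; +-assoc; +-comm; *-identityˡ; neg-distrib-+; *-distribʳ-+; pos-+; +-commutativeSemigroup)
  open import Data.Integer.Tactic.RingSolver using (solve-∀)
  open import Data.List using ([]; _∷_; map; foldr; upTo)
  open import Data.List.Properties using (map-applyUpTo)
  open import Data.Nat as ℕ using (ℕ; zero; suc; _∸_; _≤_; z≤n; s≤s)
  open import Data.Nat.Combinatorics using (_C_; nCk+nC[k+1]≡[n+1]C[k+1]; k>n⇒nCk≡0)
  open import Data.Nat.Properties using (n<1+n; +-suc)
  import Data.Nat.Properties as ℕᵖ
  open import Relation.Binary.PropositionalEquality using (_≡_; refl; sym; trans; cong; cong₂; module ≡-Reasoning)
  open ≡-Reasoning

  Σℤ-zero : (f : ℕ → ℤ) → Σℤ 0 f ≡ f 0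
  Σℤ-zero f = +-identityʳ (f 0)

  Σℤ-suc : ∀ m (f : ℕ → ℤ) → Σℤ (suc m) f ≡ f 0 + Σℤ m (λ i → f (suc i))
  Σℤ-suc m f = cong (λ xs → f 0 + foldr _+_ (+ 0) xs)
    (trans (map-applyUpTo suc f (suc m)) (sym (map-applyUpTo (λ i → i) (λ i → f (suc i)) (suc m))))

  Σℤ-cong : ∀ m {f g : ℕ → ℤ} → (∀ i → i ≤ m → f i ≡ g i) → Σℤ m f ≡ Σℤ m g
  Σℤ-cong zero f≡g = cong (_+ + 0) (f≡g 0 z≤n)
  Σℤ-cong (suc m) {f} {g} f≡g = begin
    Σℤ (suc m) f                  ≡⟨ Σℤ-suc m f ⟩
    f 0 + Σℤ m (λ i → f (suc i))  ≡⟨ cong₂ _+_ (f≡g 0 z≤n) (Σℤ-cong m λ i i≤m → f≡g (suc i) (s≤s i≤m)) ⟩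
    g 0 + Σℤ m (λ i → g (suc i))  ≡⟨ Σℤ-suc m g ⟨
    Σℤ (suc m) g                  ∎

  Σℤ-+ : ∀ m (f g : ℕ → ℤ) → Σℤ m (λ i → f i + g i) ≡ Σℤ m f + Σℤ m g
  Σℤ-+ zero f g = begin
    Σℤ 0 (λ i → f i + g i)  ≡⟨ Σℤ-zero (λ i → f i + g i) ⟩
    f 0 + g 0               ≡⟨ cong₂ _+_ (Σℤ-zero f) (Σℤ-zero g) ⟨
    Σℤ 0 f + Σℤ 0 g         ∎
  Σℤ-+ (suc m) f g = begin
    Σℤ (suc m) (λ i → f i + g i)
      ≡⟨ Σℤ-suc m (λ i → f i + g i) ⟩
    (f 0 + g 0) + Σℤ m (λ i → f (suc i) + g (suc i))
      ≡⟨ cong (_+_ (f 0 + g 0)) (Σℤ-+ m (λ i → f (suc i)) (λ i → g (suc i))) ⟩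
    (f 0 + g 0) + (Σℤ m (λ i → f (suc i)) + Σℤ m (λ i → g (suc i)))
      ≡⟨ interchange +-commutativeSemigroup (f 0) (g 0) _ _ ⟩
    (f 0 + Σℤ m (λ i → f (suc i))) + (g 0 + Σℤ m (λ i → g (suc i)))
      ≡⟨ cong₂ _+_ (Σℤ-suc m f) (Σℤ-suc m g) ⟨
    Σℤ (suc m) f + Σℤ (suc m) g ∎

  Σℤ-neg : ∀ m (f : ℕ → ℤ) → Σℤ m (λ i → - f i) ≡ - Σℤ m f
  Σℤ-neg zero f = trans (Σℤ-zero (λ i → - f i)) (cong -_ (sym (Σℤ-zero f)))
  Σℤ-neg (suc m) f = begin
    Σℤ (suc m) (λ i → - f i)              ≡⟨ Σℤ-suc m (λ i → - f i) ⟩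
    - f 0 + Σℤ m (λ i → - f (suc i))      ≡⟨ cong (_+_ (- f 0)) (Σℤ-neg m (λ i → f (suc i))) ⟩
    - f 0 + - Σℤ m (λ i → f (suc i))      ≡⟨ neg-distrib-+ (f 0) _ ⟨
    - (f 0 + Σℤ m (λ i → f (suc i)))      ≡⟨ cong -_ (Σℤ-suc m f) ⟨
    - Σℤ (suc m) f                        ∎

  Σℤ-snoc : ∀ m (f : ℕ → ℤ) → Σℤ (suc m) f ≡ Σℤ m f + f (suc m)
  Σℤ-snoc zero f = begin
    Σℤ 1 f       ≡⟨ Σℤ-suc 0 f ⟩
    f 0 + Σℤ 0 (λ i → f (suc i)) ≡⟨ cong₂ _+_ (sym (Σℤ-zero f)) (Σℤ-zero (λ i → f (suc i))) ⟩
    Σℤ 0 f + f 1 ∎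
  Σℤ-snoc (suc m) f = begin
    Σℤ (suc (suc m)) f                               ≡⟨ Σℤ-suc (suc m) f ⟩
    f 0 + Σℤ (suc m) (λ i → f (suc i))               ≡⟨ cong (_+_ (f 0)) (Σℤ-snoc m (λ i → f (suc i))) ⟩
    f 0 + (Σℤ m (λ i → f (suc i)) + f (suc (suc m))) ≡⟨ +-assoc (f 0) _ _ ⟨
    f 0 + Σℤ m (λ i → f (suc i)) + f (suc (suc m))   ≡⟨ cong (_+ f (suc (suc m))) (Σℤ-suc m f) ⟨
    Σℤ (suc m) f + f (suc (suc m))                   ∎

  Σℤ-reverse : ∀ m (f : ℕ → ℤ) → Σℤ m f ≡ Σℤ m (λ i → f (m ∸ i))
  Σℤ-reverse zero f = refl
  Σℤ-reverse (suc m) f = begin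
    Σℤ (suc m) f                             ≡⟨ Σℤ-snoc m f ⟩
    Σℤ m f + f (suc m)                       ≡⟨ cong (_+ f (suc m)) (Σℤ-reverse m f) ⟩
    Σℤ m (λ i → f (m ∸ i)) + f (suc m)       ≡⟨ +-comm _ (f (suc m)) ⟩
    f (suc m) + Σℤ m (λ i → f (m ∸ i))       ≡⟨ Σℤ-suc m (λ i → f (suc m ∸ i)) ⟨
    Σℤ (suc m) (λ i → f (suc m ∸ i))         ∎

  Σℤ-pascal : ∀ k (F : ℕ → ℤ) →
    Σℤ (suc k) (λ i → + (suc k C i) * F i) ≡
    Σℤ k (λ i → + (k C i) * F i) + Σℤ k (λ i → + (k C i) * F (suc i))
  Σℤ-pascal k F = begin
    Σℤ (suc k) (λ i → + (suc k C i) * F i)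
      ≡⟨ Σℤ-suc k (λ i → + (suc k C i) * F i) ⟩
    + 1 * F 0 + Σℤ k (λ i → + (suc k C suc i) * F (suc i))
      ≡⟨ cong₂ _+_ (*-identityˡ (F 0)) (Σℤ-cong k λ i _ → split i) ⟩
    F 0 + Σℤ k (λ i → + (k C i) * F (suc i) + + (k C suc i) * F (suc i))
      ≡⟨ cong (_+_ (F 0)) (Σℤ-+ k (λ i → + (k C i) * F (suc i)) (λ i → + (k C suc i) * F (suc i))) ⟩
    F 0 + (shifted + aligned)
      ≡⟨ x∙yz≈xz∙y +-commutativeSemigroup (F 0) shifted aligned ⟩
    F 0 + aligned + shifted
      ≡⟨ cong (_+ shifted) peel ⟨
    Σℤ k (λ i → + (k C i) * F i) + shifted ∎
    where
    shifted aligned : ℤ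
    shifted = Σℤ k (λ i → + (k C i) * F (suc i))
    aligned = Σℤ k (λ i → + (k C suc i) * F (suc i))

    split : ∀ i → + (suc k C suc i) * F (suc i) ≡ + (k C i) * F (suc i) + + (k C suc i) * F (suc i)
    split i = begin
      + (suc k C suc i) * F (suc i)
        ≡⟨ cong (λ c → + c * F (suc i)) (nCk+nC[k+1]≡[n+1]C[k+1] k i) ⟨
      + (k C i ℕ.+ k C suc i) * F (suc i)
        ≡⟨ cong (_* F (suc i)) (pos-+ (k C i) (k C suc i)) ⟩
      (+ (k C i) + + (k C suc i)) * F (suc i)
        ≡⟨ *-distribʳ-+ (F (suc i)) (+ (k C i)) (+ (k C suc i)) ⟩
      + (k C i) * F (suc i) + + (k C suc i) * F (suc i) ∎

    peel : Σℤ k (λ i → + (k C i) * F i) ≡ F 0 + aligned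
    peel = begin
      Σℤ k (λ i → + (k C i) * F i)
        ≡⟨ +-identityʳ _ ⟨
      Σℤ k (λ i → + (k C i) * F i) + + 0
        ≡⟨ cong (λ c → Σℤ k (λ i → + (k C i) * F i) + + c * F (suc k)) (k>n⇒nCk≡0 (n<1+n k)) ⟨
      Σℤ k (λ i → + (k C i) * F i) + + (k C suc k) * F (suc k)
        ≡⟨ Σℤ-snoc k (λ i → + (k C i) * F i) ⟨
      Σℤ (suc k) (λ i → + (k C i) * F i)
        ≡⟨ Σℤ-suc k (λ i → + (k C i) * F i) ⟩
      + 1 * F 0 + aligned
        ≡⟨ cong (_+ aligned) (*-identityˡ (F 0)) ⟩
      F 0 + aligned ∎

  Σℕ-as-Σℤ : ∀ m (f : ℕ → ℕ) → + Σℕ m f ≡ Σℤ m (λ i → + f i)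
  Σℕ-as-Σℤ m f = pos-foldr (upTo (suc m))
    where
    pos-foldr : ∀ xs → + foldr ℕ._+_ 0 (map f xs) ≡ foldr _+_ (+ 0) (map (λ i → + f i) xs)
    pos-foldr [] = refl
    pos-foldr (x ∷ xs) = trans (pos-+ (f x) _) (cong (_+_ (+ f x)) (pos-foldr xs))

  PascalRecurrence : (ℕ → ℕ → ℤ) → Set
  PascalRecurrence g = ∀ k m → g (suc k) m ≡ g k (suc m) + g k m

  module _ (g : ℕ → ℕ → ℤ) (recurrence : PascalRecurrence g) where

    pascal-row-expansion : ∀ k m → g k m ≡ Σℤ k (λ i → + (k C i) * g 0 (k ℕ.+ m ∸ i))
    pascal-row-expansion zero m = sym (trans (Σℤ-zero (λ i → + (0 C i) * g 0 (m ∸ i))) (*-identityˡ (g 0 m)))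
    pascal-row-expansion (suc k) m = begin
      g (suc k) m
        ≡⟨ recurrence k m ⟩
      g k (suc m) + g k m
        ≡⟨ cong₂ _+_ (pascal-row-expansion k (suc m)) (pascal-row-expansion k m) ⟩
      Σℤ k (λ i → + (k C i) * g 0 (k ℕ.+ suc m ∸ i)) + Σℤ k (λ i → + (k C i) * F (suc i))
        ≡⟨ cong (_+ Σℤ k (λ i → + (k C i) * F (suc i)))
                (Σℤ-cong k λ i _ → cong (λ n → + (k C i) * g 0 (n ∸ i)) (+-suc k m)) ⟩
      Σℤ k (λ i → + (k C i) * F i) + Σℤ k (λ i → + (k C i) * F (suc i))
        ≡⟨ Σℤ-pascal k F ⟨
      Σℤ (suc k) (λ i → + (suc k C i) * F i) ∎
      where
      -- F (suc i) reduces to g 0 (k + m ∸ i)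
      F : ℕ → ℤ
      F i = g 0 (suc k ℕ.+ m ∸ i)

    pascal-column-expansion : ∀ k m → g k m ≡ Σℤ m (λ i → sgn i * + (m C i) * g (k ℕ.+ m ∸ i) 0)
    pascal-column-expansion k zero = sym (begin
      Σℤ 0 (λ i → sgn i * + (0 C i) * g (k ℕ.+ 0 ∸ i) 0)
        ≡⟨ Σℤ-zero (λ i → sgn i * + (0 C i) * g (k ℕ.+ 0 ∸ i) 0) ⟩
      + 1 * g (k ℕ.+ 0) 0
        ≡⟨ *-identityˡ (g (k ℕ.+ 0) 0) ⟩
      g (k ℕ.+ 0) 0
        ≡⟨ cong (λ n → g n 0) (ℕᵖ.+-identityʳ k) ⟩
      g k 0 ∎)
    pascal-column-expansion k (suc m) = begin
      g k (suc m)
        ≡⟨ a≡a+b-b (g k (suc m)) (g k m) ⟩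
      g k (suc m) + g k m - g k m
        ≡⟨ cong (_- g k m) (recurrence k m) ⟨
      g (suc k) m - g k m
        ≡⟨ cong₂ _-_ (pascal-column-expansion (suc k) m) (pascal-column-expansion k m) ⟩
      Σℤ m (λ i → sgn i * + (m C i) * g (suc k ℕ.+ m ∸ i) 0) - Σℤ m (λ i → sgn i * + (m C i) * g (k ℕ.+ m ∸ i) 0)
        ≡⟨ cong₂ _+_ (Σℤ-cong m λ i _ → s*c*t≡c*[s*t] (sgn i) (+ (m C i)) (g (suc k ℕ.+ m ∸ i) 0))
                     (sym (Σℤ-neg m (λ i → sgn i * + (m C i) * g (k ℕ.+ m ∸ i) 0))) ⟩
      Σℤ m (λ i → + (m C i) * F i) + Σℤ m (λ i → - (sgn i * + (m C i) * g (k ℕ.+ m ∸ i) 0))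
        ≡⟨ cong (_+_ (Σℤ m (λ i → + (m C i) * F i)))
                (Σℤ-cong m λ i _ → -[s*c*t]≡c*[-s*t] (sgn i) (+ (m C i)) (g (k ℕ.+ m ∸ i) 0)) ⟩
      Σℤ m (λ i → + (m C i) * F i) + Σℤ m (λ i → + (m C i) * F (suc i))
        ≡⟨ Σℤ-pascal m F ⟨
      Σℤ (suc m) (λ i → + (suc m C i) * F i)
        ≡⟨ Σℤ-cong (suc m) (λ i _ → unshift i) ⟩
      Σℤ (suc m) (λ i → sgn i * + (suc m C i) * g (k ℕ.+ suc m ∸ i) 0) ∎
      where
      -- F (suc i) reduces to - sgn i * g (k + m ∸ i) 0
      F : ℕ → ℤ
      F i = sgn i * g (suc k ℕ.+ m ∸ i) 0
      a≡a+b-b : ∀ a b → a ≡ a + b - b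
      a≡a+b-b = solve-∀
      s*c*t≡c*[s*t] : ∀ s c t → s * c * t ≡ c * (s * t)
      s*c*t≡c*[s*t] = solve-∀
      -[s*c*t]≡c*[-s*t] : ∀ s c t → - (s * c * t) ≡ c * (- s * t)
      -[s*c*t]≡c*[-s*t] = solve-∀
      unshift : ∀ i → + (suc m C i) * F i ≡ sgn i * + (suc m C i) * g (k ℕ.+ suc m ∸ i) 0
      unshift i = begin
        + (suc m C i) * F i
          ≡⟨ s*c*t≡c*[s*t] (sgn i) (+ (suc m C i)) _ ⟨
        sgn i * + (suc m C i) * g (suc k ℕ.+ m ∸ i) 0
          ≡⟨ cong (λ n → sgn i * + (suc m C i) * g (n ∸ i) 0) (+-suc k m) ⟨
        sgn i * + (suc m C i) * g (k ℕ.+ suc m ∸ i) 0 ∎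

module TransferOperators where
  open import Data.List using (List; []; _∷_; [_]; _++_; map; concatMap; filter; length)
  open import Data.List.Properties using (map-++; map-∘; map-cong; concatMap-map)
  open import Data.Nat.ListAction using (sum)
  open import Data.Nat.ListAction.Properties using (sum-++)
  open import Data.Maybe using (Maybe; just; nothing; maybe′; _>>=_)
  open import Data.Nat using (ℕ; zero; suc; _+_; _*_; _∸_)
  open import Data.Nat.Properties using (+-identityʳ; +-comm; *-suc; +-commutativeSemigroup)
  open import Data.Nat.Tactic.RingSolver using (solve-∀)
  open import Algebra.Properties.CommutativeSemigroup using (interchange)
  open import Data.Empty using (⊥-elim)
  open import Function.Endo.Propositional (ℕ → ℕ) using (_^_; ^-homo)
  open import Relation.Binary.PropositionalEquality
    using (_≡_; refl; sym; trans; cong; cong₂; _≗_; module ≡-Reasoning)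
  open import Relation.Binary.Core using (_Preserves_⟶_)
  open import Relation.Nullary using (¬_; yes; no)

  weigh : (ℕ → ℕ) → Maybe ℕ → ℕ
  weigh T = maybe′ T 0

  count : List (List Step) → (ℕ → ℕ) → ℕ → ℕ
  count ws T h = sum (map (λ w → weigh T (walk h w)) ws)

  transfer : List Step → (ℕ → ℕ) → ℕ → ℕ
  transfer A = count (map [_] A)

  onAxis : ℕ → ℕ
  onAxis zero = 1
  onAxis (suc _) = 0

  walk-++ : ∀ h p q → walk h (p ++ q) ≡ (walk h p >>= λ h′ → walk h′ q)
  walk-++ h [] q = refl
  walk-++ h (up1 ∷ p) q = walk-++ (suc h) p q
  walk-++ h (up2 ∷ p) q = walk-++ (suc (suc h)) p q
  walk-++ zero (down1 ∷ p) q = refl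
  walk-++ (suc h) (down1 ∷ p) q = walk-++ h p q
  walk-++ zero (down2 ∷ p) q = refl
  walk-++ (suc zero) (down2 ∷ p) q = refl
  walk-++ (suc (suc h)) (down2 ∷ p) q = walk-++ h p q
  walk-++ zero (flat ∷ p) q = refl
  walk-++ (suc h) (flat ∷ p) q = walk-++ (suc h) p q

  count-cong : ∀ ws {T T′} → T ≗ T′ → count ws T ≗ count ws T′
  count-cong ws T≗T′ h = cong sum (map-cong (λ w → weigh-cong (walk h w)) ws)
    where
    weigh-cong : ∀ mh → weigh _ mh ≡ weigh _ mh
    weigh-cong nothing = refl
    weigh-cong (just h′) = T≗T′ h′

  count-++ : ∀ ws vs T h → count (ws ++ vs) T h ≡ count ws T h + count vs T h
  count-++ ws vs T h = trans (cong sum (map-++ _ ws vs)) (sum-++ (map _ ws) _)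

  count-prefix : ∀ p Q T h → count (map (p ++_) Q) T h ≡ weigh (count Q T) (walk h p)
  count-prefix p Q T h = begin
    count (map (p ++_) Q) T h
      ≡⟨ cong sum (map-∘ Q) ⟨
    sum (map (λ q → weigh T (walk h (p ++ q))) Q)
      ≡⟨ cong sum (map-cong (λ q → cong (weigh T) (walk-++ h p q)) Q) ⟩
    sum (map (λ q → weigh T (walk h p >>= λ h′ → walk h′ q)) Q)
      ≡⟨ continue (walk h p) ⟩
    weigh (count Q T) (walk h p) ∎
    where
    open ≡-Reasoning
    continue : ∀ mh → sum (map (λ q → weigh T (mh >>= λ h′ → walk h′ q)) Q) ≡ weigh (count Q T) mh
    continue nothing = sum-zeros Q
      where
      sum-zeros : ∀ (xs : List (List Step)) → sum (map (λ _ → 0) xs) ≡ 0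
      sum-zeros [] = refl
      sum-zeros (_ ∷ xs) = sum-zeros xs
    continue (just h′) = refl

  count-concatMap : ∀ {X : Set} (f : X → List Step) P Q T h →
    count (concatMap (λ x → map (f x ++_) Q) P) T h ≡ sum (map (λ x → weigh (count Q T) (walk h (f x))) P)
  count-concatMap f [] Q T h = refl
  count-concatMap f (x ∷ P) Q T h = trans (count-++ (map (f x ++_) Q) _ T h)
    (cong₂ _+_ (count-prefix (f x) Q T h) (count-concatMap f P Q T h))

  count-words : ∀ {A F} → (∀ T → transfer A T ≗ F T) → ∀ m T → count (words A m) T ≗ (F ^ m) T
  count-words transfer≗F zero T h = +-identityʳ (T h)
  count-words {A} {F} transfer≗F (suc m) T h = begin
    count (words A (suc m)) T h
      ≡⟨ cong (λ ws → count ws T h) (concatMap-map _ [_] A) ⟨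
    count (concatMap (λ p → map (p ++_) (words A m)) (map [_] A)) T h
                                                               ≡⟨ count-concatMap (λ p → p) (map [_] A) (words A m) T h ⟩
    transfer A (count (words A m) T) h
      ≡⟨ count-cong (map [_] A) (count-words transfer≗F m T) h ⟩
    transfer A ((F ^ m) T) h
      ≡⟨ transfer≗F ((F ^ m) T) h ⟩
    (F ^ suc m) T h ∎
    where open ≡-Reasoning

  weigh-onAxis : ∀ mh → ¬ mh ≡ just 0 → weigh onAxis mh ≡ 0
  weigh-onAxis nothing _ = refl
  weigh-onAxis (just zero) ≢just0 = ⊥-elim (≢just0 refl)
  weigh-onAxis (just (suc _)) _ = refl

  length-filter-admissible : ∀ ws → length (filter admissible? ws) ≡ count ws onAxis 0
  length-filter-admissible [] = refl
  length-filter-admissible (w ∷ ws) with admissible? w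
  ... | yes ends-at-0 rewrite ends-at-0 = cong suc (length-filter-admissible ws)
  ... | no ¬ends-at-0 = trans (length-filter-admissible ws)
    (cong (_+ count ws onAxis 0) (sym (weigh-onAxis (walk 0 w) ¬ends-at-0)))

  dyckStep riordanStep doubleStep : (ℕ → ℕ) → ℕ → ℕ
  dyckStep T zero = T 1
  dyckStep T (suc h) = T (suc (suc h)) + T h
  riordanStep T zero = T 1
  riordanStep T (suc h) = T (suc (suc h)) + (T (suc h) + T h)
  doubleStep T zero = T 2
  doubleStep T (suc zero) = T 3 + T 1
  doubleStep T (suc (suc h)) = T (4 + h) + (T (2 + h) + T h)

  transfer-dyck : ∀ T → transfer (up1 ∷ down1 ∷ []) T ≗ dyckStep T
  transfer-dyck T zero = +-identityʳ (T 1)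
  transfer-dyck T (suc h) = cong (T (suc (suc h)) +_) (+-identityʳ (T h))

  transfer-riordan : ∀ T → transfer (up1 ∷ flat ∷ down1 ∷ []) T ≗ riordanStep T
  transfer-riordan T zero = +-identityʳ (T 1)
  transfer-riordan T (suc h) = cong (λ t → T (suc (suc h)) + (T (suc h) + t)) (+-identityʳ (T h))

  transfer-double : ∀ T → transfer (up2 ∷ flat ∷ down2 ∷ []) T ≗ doubleStep T
  transfer-double T zero = +-identityʳ (T 2)
  transfer-double T (suc zero) = cong (T 3 +_) (+-identityʳ (T 1))
  transfer-double T (suc (suc h)) = cong (λ t → T (4 + h) + (T (2 + h) + t)) (+-identityʳ (T h))

  double : ℕ → ℕ
  double zero = zero
  double (suc h) = suc (suc (double h))

  doubleStep-riordanStep : ∀ {T T′} → (∀ h → T (double h) ≡ T′ h) →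
    ∀ m h → (doubleStep ^ m) T (double h) ≡ (riordanStep ^ m) T′ h
  doubleStep-riordanStep T≡T′ zero h = T≡T′ h
  doubleStep-riordanStep T≡T′ (suc m) zero = doubleStep-riordanStep T≡T′ m 1
  doubleStep-riordanStep T≡T′ (suc m) (suc h) =
    cong₂ _+_ (doubleStep-riordanStep T≡T′ m (2 + h))
              (cong₂ _+_ (doubleStep-riordanStep T≡T′ m (suc h)) (doubleStep-riordanStep T≡T′ m h))

  dyckStep² : ∀ T h → dyckStep (dyckStep T) h ≡ doubleStep T h + T h
  dyckStep² T zero = refl
  dyckStep² T (suc zero) = refl
  dyckStep² T (suc (suc h)) = regroup (T (4 + h)) (T (2 + h)) (T h)
    where
    regroup : ∀ a b c → a + b + (b + c) ≡ a + (b + c) + b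
    regroup = solve-∀

  Additive : ((ℕ → ℕ) → ℕ → ℕ) → Set
  Additive F = ∀ T T′ → F (λ h → T h + T′ h) ≗ λ h → F T h + F T′ h

  ^-preserves-≗ : ∀ {F} → F Preserves _≗_ ⟶ _≗_ → ∀ m → (F ^ m) Preserves _≗_ ⟶ _≗_
  ^-preserves-≗ F-cong zero T≗T′ = T≗T′
  ^-preserves-≗ F-cong (suc m) T≗T′ = F-cong (^-preserves-≗ F-cong m T≗T′)

  ^-additive : ∀ {F} → F Preserves _≗_ ⟶ _≗_ → Additive F → ∀ m → Additive (F ^ m)
  ^-additive F-cong F-additive zero T T′ h = refl
  ^-additive {F} F-cong F-additive (suc m) T T′ h =
    trans (F-cong (^-additive F-cong F-additive m T T′) h) (F-additive ((F ^ m) T) ((F ^ m) T′) h)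

  dyckStep-cong : dyckStep Preserves _≗_ ⟶ _≗_
  dyckStep-cong T≗T′ zero = T≗T′ 1
  dyckStep-cong T≗T′ (suc h) = cong₂ _+_ (T≗T′ (suc (suc h))) (T≗T′ h)

  dyckStep-additive : Additive dyckStep
  dyckStep-additive T T′ zero = refl
  dyckStep-additive T T′ (suc h) =
    interchange +-commutativeSemigroup (T (suc (suc h))) (T′ (suc (suc h))) (T h) (T′ h)

  crTable : ℕ → ℕ → ℕ
  crTable k m = (dyckStep ^ (2 * k)) ((doubleStep ^ m) onAxis) 0

  CR≡crTable : ∀ n k → CR n k ≡ crTable k (n ∸ k)
  CR≡crTable n k = begin
    CR n k
      ≡⟨ length-filter-admissible (crCandidates n k) ⟩
    count (crCandidates n k) onAxis 0
      ≡⟨ count-concatMap (λ p → p) (words _ (2 * k)) (words _ (n ∸ k)) onAxis 0 ⟩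
    count (words _ (2 * k)) (count (words _ (n ∸ k)) onAxis) 0
      ≡⟨ count-cong (words _ (2 * k)) (count-words transfer-double (n ∸ k) onAxis) 0 ⟩
    count (words _ (2 * k)) ((doubleStep ^ (n ∸ k)) onAxis) 0
      ≡⟨ count-words transfer-dyck (2 * k) _ 0 ⟩
    crTable k (n ∸ k) ∎
    where open ≡-Reasoning

  R≡crTable : ∀ n → R n ≡ crTable 0 n
  R≡crTable n = begin
    R n                                        ≡⟨ length-filter-admissible (words _ n) ⟩
    count (words _ n) onAxis 0                 ≡⟨ count-words transfer-riordan n onAxis 0 ⟩
    (riordanStep ^ n) onAxis 0                 ≡⟨ doubleStep-riordanStep onAxis-double n 0 ⟨
    crTable 0 n                                ∎
    where
    open ≡-Reasoning
    onAxis-double : ∀ h → onAxis (double h) ≡ onAxis h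
    onAxis-double zero = refl
    onAxis-double (suc h) = refl

  crTable-pascal : ∀ k m → crTable (suc k) m ≡ crTable k (suc m) + crTable k m
  crTable-pascal k m = begin
    (dyckStep ^ (2 * suc k)) B^m 0
      ≡⟨ cong (λ n → (dyckStep ^ n) B^m 0) (trans (*-suc 2 k) (+-comm 2 (2 * k))) ⟩
    (dyckStep ^ (2 * k + 2)) B^m 0
      ≡⟨ cong (λ f → f B^m 0) (^-homo dyckStep (2 * k) 2) ⟩
    (dyckStep ^ (2 * k)) (dyckStep (dyckStep B^m)) 0
      ≡⟨ ^-preserves-≗ dyckStep-cong (2 * k) (dyckStep² B^m) 0 ⟩
    (dyckStep ^ (2 * k)) (λ h → doubleStep B^m h + B^m h) 0
      ≡⟨ ^-additive dyckStep-cong dyckStep-additive (2 * k) (doubleStep B^m) B^m 0 ⟩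
    crTable k (suc m) + crTable k m ∎
    where
    open ≡-Reasoning
    B^m : ℕ → ℕ
    B^m = (doubleStep ^ m) onAxis

module DyckWalks where
  open TransferOperators
  open import Data.Nat using (ℕ; zero; suc; _+_; _*_; _∸_; _<_; _≤_; s≤s)
  open import Data.Nat.Combinatorics using (_C_; nCk+nC[k+1]≡[n+1]C[k+1]; nCk≡nC[n∸k]; nC1≡n)
  open import Data.Nat.DivMod using (_/_; m*n/n≡m)
  open import Data.Nat.Properties
    using ( +-identityʳ; +-comm; +-assoc; +-suc; *-comm; *-zeroʳ; *-identityˡ; *-identityʳ; *-distribˡ-+
          ; +-cancelʳ-≡; +-commutativeSemigroup; m≤n⇒m≤1+n; m≤m+n; m+n∸n≡m; m<n⇒m<1+n; n<1+n)
  open import Data.Nat.Tactic.RingSolver using (solve-∀)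
  open import Algebra.Properties.CommutativeSemigroup using (interchange)
  open import Function.Endo.Propositional (ℕ → ℕ) using (_^_)
  open import Relation.Binary.PropositionalEquality
    using (_≡_; refl; sym; trans; cong; cong₂; subst; module ≡-Reasoning)
  open ≡-Reasoning

  [1+k]*nC[1+k]+k*nCk≡n*nCk : ∀ n k → suc k * (n C suc k) + k * (n C k) ≡ n * (n C k)
  [1+k]*nC[1+k]+k*nCk≡n*nCk zero zero = refl
  [1+k]*nC[1+k]+k*nCk≡n*nCk zero (suc k) = cong₂ _+_ (*-zeroʳ (suc (suc k))) (*-zeroʳ (suc k))
  [1+k]*nC[1+k]+k*nCk≡n*nCk (suc n) zero = begin
    1 * (suc n C 1) + 0  ≡⟨ +-identityʳ _ ⟩
    1 * (suc n C 1)      ≡⟨ *-identityˡ _ ⟩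
    suc n C 1            ≡⟨ nC1≡n (suc n) ⟩
    suc n                ≡⟨ *-identityʳ (suc n) ⟨
    suc n * 1            ∎
  [1+k]*nC[1+k]+k*nCk≡n*nCk (suc n) (suc k) = begin
    suc (suc k) * (suc n C suc (suc k)) + suc k * (suc n C suc k)
      ≡⟨ cong₂ (λ x y → suc (suc k) * x + suc k * y)
               (nCk+nC[k+1]≡[n+1]C[k+1] n (suc k)) (nCk+nC[k+1]≡[n+1]C[k+1] n k) ⟨
    suc (suc k) * (c₁ + c₂) + suc k * (c₀ + c₁)
      ≡⟨ regroup k c₀ c₁ c₂ ⟩
    (suc (suc k) * c₂ + suc k * c₁) + (suc k * c₁ + k * c₀) + (c₀ + c₁)
      ≡⟨ cong₂ (λ x y → x + y + (c₀ + c₁))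
               ([1+k]*nC[1+k]+k*nCk≡n*nCk n (suc k)) ([1+k]*nC[1+k]+k*nCk≡n*nCk n k) ⟩
    n * c₁ + n * c₀ + (c₀ + c₁)
      ≡⟨ collect n c₀ c₁ ⟩
    suc n * (c₀ + c₁)
      ≡⟨ cong (suc n *_) (nCk+nC[k+1]≡[n+1]C[k+1] n k) ⟩
    suc n * (suc n C suc k) ∎
    where
    c₀ = n C k
    c₁ = n C suc k
    c₂ = n C suc (suc k)
    regroup : ∀ k c₀ c₁ c₂ → suc (suc k) * (c₁ + c₂) + suc k * (c₀ + c₁) ≡
                             (suc (suc k) * c₂ + suc k * c₁) + (suc k * c₁ + k * c₀) + (c₀ + c₁)
    regroup = solve-∀
    collect : ∀ n c₀ c₁ → n * c₁ + n * c₀ + (c₀ + c₁) ≡ suc n * (c₀ + c₁)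
    collect = solve-∀

  double-+ : ∀ n → double n ≡ n + n
  double-+ zero = refl
  double-+ (suc n) = cong suc (trans (cong suc (double-+ n)) (sym (+-suc n n)))

  C-middle : ∀ j → suc (double j) C j ≡ suc (double j) C suc j
  C-middle j = trans (nCk≡nC[n∸k] (m≤n⇒m≤1+n j≤double)) (cong (suc (double j) C_) complement)
    where
    j≤double : j ≤ double j
    j≤double = subst (j ≤_) (sym (double-+ j)) (m≤m+n j j)
    complement : suc (double j) ∸ j ≡ suc j
    complement = trans (cong (λ d → suc d ∸ j) (double-+ j)) (m+n∸n≡m (suc j) j)

  2*≡double : ∀ n → 2 * n ≡ double n
  2*≡double n = trans (cong (n +_) (+-identityʳ n)) (sym (double-+ n))

  dyckWalks : ℕ → ℕ → ℕ
  dyckWalks m = (dyckStep ^ m) onAxis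

  dyckWalks-short : ∀ {m h} → m < h → dyckWalks m h ≡ 0
  dyckWalks-short {zero} {suc h} _ = refl
  dyckWalks-short {suc m} {suc h} (s≤s m<h) =
    cong₂ _+_ (dyckWalks-short (m<n⇒m<1+n (m<n⇒m<1+n m<h))) (dyckWalks-short m<h)

  dyckWalks-diagonal : ∀ h → dyckWalks h h ≡ 1
  dyckWalks-diagonal zero = refl
  dyckWalks-diagonal (suc h) =
    cong₂ _+_ (dyckWalks-short (m<n⇒m<1+n (n<1+n h))) (dyckWalks-diagonal h)

  ballot : ∀ i h → let m = h + double (suc i) in dyckWalks m h + m C i ≡ m C suc i
  ballot zero zero = refl
  ballot zero (suc h) = begin
    dyckWalks m (2 + h) + dyckWalks m h + 1  ≡⟨ cong (λ x → x + dyckWalks m h + 1) top ⟩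
    suc (dyckWalks m h + m C 0)              ≡⟨ cong suc (ballot zero h) ⟩
    m C 0 + m C 1                            ≡⟨ nCk+nC[k+1]≡[n+1]C[k+1] m 0 ⟩
    suc m C 1                                ∎
    where
    m = h + 2
    top : dyckWalks m (2 + h) ≡ 1
    top = trans (cong (λ n → dyckWalks n (2 + h)) (+-comm h 2)) (dyckWalks-diagonal (2 + h))
  ballot (suc i) zero = begin
    a + suc m C suc i               ≡⟨ cong (a +_) (nCk+nC[k+1]≡[n+1]C[k+1] m i) ⟨
    a + (m C i + m C suc i)         ≡⟨ +-assoc a _ _ ⟨
    (a + m C i) + m C suc i         ≡⟨ cong (_+ m C suc i) (ballot i 1) ⟩
    m C suc i + m C suc i           ≡⟨ cong (m C suc i +_) (C-middle (suc i)) ⟩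
    m C suc i + m C suc (suc i)     ≡⟨ nCk+nC[k+1]≡[n+1]C[k+1] m (suc i) ⟩
    suc m C suc (suc i)             ∎
    where
    m = suc (double (suc i))
    a = dyckWalks m 1
  ballot (suc i) (suc h) = begin
    a + b + suc m C suc i           ≡⟨ cong (a + b +_) (nCk+nC[k+1]≡[n+1]C[k+1] m i) ⟨
    a + b + (m C i + m C suc i)     ≡⟨ interchange +-commutativeSemigroup a b _ _ ⟩
    (a + m C i) + (b + m C suc i)   ≡⟨ cong₂ _+_ shifted (ballot (suc i) h) ⟩
    m C suc i + m C suc (suc i)     ≡⟨ nCk+nC[k+1]≡[n+1]C[k+1] m (suc i) ⟩
    suc m C suc (suc i)             ∎
    where
    m = h + double (suc (suc i))
    a = dyckWalks m (2 + h)
    b = dyckWalks m h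
    m≡ : 2 + h + double (suc i) ≡ m
    m≡ = sym (trans (+-suc h _) (cong suc (+-suc h _)))
    shifted : a + m C i ≡ m C suc i
    shifted = subst (λ n → dyckWalks n (2 + h) + n C i ≡ n C suc i) m≡ (ballot i (2 + h))

  catalan-numerator : ∀ n → suc n * dyckWalks (2 * n) 0 ≡ (2 * n) C n
  catalan-numerator zero = refl
  catalan-numerator (suc i) =
    subst (λ n → suc (suc i) * dyckWalks n 0 ≡ n C suc i) (sym (2*≡double (suc i)))
          (+-cancelʳ-≡ (suc (suc i) * a) _ _ cancelled)
    where
    m = double (suc i)
    N = dyckWalks m 0
    a = m C i
    c = m C suc i
    absorbed : suc i * c ≡ suc (suc i) * a
    absorbed = +-cancelʳ-≡ (i * a) _ _ (begin
      suc i * c + i * a             ≡⟨ [1+k]*nC[1+k]+k*nCk≡n*nCk m i ⟩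
      m * a                         ≡⟨ cong (λ d → suc (suc d) * a) (double-+ i) ⟩
      suc (suc (i + i)) * a         ≡⟨ split i a ⟩
      suc (suc i) * a + i * a       ∎)
      where
      split : ∀ i a → suc (suc (i + i)) * a ≡ suc (suc i) * a + i * a
      split = solve-∀
    cancelled : suc (suc i) * N + suc (suc i) * a ≡ c + suc (suc i) * a
    cancelled = begin
      suc (suc i) * N + suc (suc i) * a  ≡⟨ *-distribˡ-+ (suc (suc i)) N a ⟨
      suc (suc i) * (N + a)              ≡⟨ cong (suc (suc i) *_) (ballot i 0) ⟩
      c + suc i * c                      ≡⟨ cong (c +_) absorbed ⟩
      c + suc (suc i) * a                ∎

  Cat≡crTable : ∀ n → Cat n ≡ crTable n 0
  Cat≡crTable n = begin
    ((2 * n) C n) / suc n ≡⟨ cong (_/ suc n) (catalan-numerator n) ⟨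
    suc n * N / suc n     ≡⟨ cong (_/ suc n) (*-comm (suc n) N) ⟩
    N * suc n / suc n     ≡⟨ m*n/n≡m N (suc n) ⟩
    N                     ∎
    where
    N = dyckWalks (2 * n) 0

open BinomialSums
open TransferOperators
open DyckWalks

open import Data.Nat using (ℕ; suc; _≤_; _∸_)
open import Data.Nat.Properties using (+-identityʳ; m+[n∸m]≡n; m∸[m∸n]≡n)
open import Data.Nat.Combinatorics using (_C_; nCk≡nC[n∸k])
open import Data.Integer using (+_; _*_)
open import Data.Integer.Properties using (pos-+; pos-*; +-injective)
open import Data.Product using (_×_; _,_)
open import Relation.Binary.PropositionalEquality using (_≡_; sym; trans; cong; cong₂; module ≡-Reasoning)
open ≡-Reasoning

crTable-recurrence : PascalRecurrence (λ k m → + crTable k m)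
crTable-recurrence k m = trans (cong +_ (crTable-pascal k m)) (pos-+ (crTable k (suc m)) (crTable k m))

crTable-row : ∀ k m → + crTable k m ≡ Σℤ k (λ i → + (k C i) * + crTable 0 (k Data.Nat.+ m ∸ i))
crTable-row = pascal-row-expansion _ crTable-recurrence

crTable-column : ∀ k m → + crTable k m ≡ Σℤ m (λ i → sgn i * + (m C i) * + crTable (k Data.Nat.+ m ∸ i) 0)
crTable-column = pascal-column-expansion _ crTable-recurrence

CR-via-R : ∀ n k → k ≤ n → CR n k ≡ Σℕ k (λ i → (k C i) Data.Nat.* R (n ∸ i))
CR-via-R n k k≤n = +-injective (begin
  + CR n k
    ≡⟨ cong +_ (CR≡crTable n k) ⟩
  + crTable k (n ∸ k)
    ≡⟨ crTable-row k (n ∸ k) ⟩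
  Σℤ k (λ i → + (k C i) * + crTable 0 (k Data.Nat.+ (n ∸ k) ∸ i))
    ≡⟨ Σℤ-cong k (λ i _ → term i) ⟩
  Σℤ k (λ i → + ((k C i) Data.Nat.* R (n ∸ i)))
    ≡⟨ Σℕ-as-Σℤ k (λ i → (k C i) Data.Nat.* R (n ∸ i)) ⟨
  + Σℕ k (λ i → (k C i) Data.Nat.* R (n ∸ i)) ∎)
  where
  term : ∀ i → + (k C i) * + crTable 0 (k Data.Nat.+ (n ∸ k) ∸ i) ≡ + ((k C i) Data.Nat.* R (n ∸ i))
  term i = begin
    + (k C i) * + crTable 0 (k Data.Nat.+ (n ∸ k) ∸ i)
      ≡⟨ cong (λ j → + (k C i) * + crTable 0 (j ∸ i)) (m+[n∸m]≡n k≤n) ⟩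
    + (k C i) * + crTable 0 (n ∸ i)
      ≡⟨ cong (λ r → + (k C i) * + r) (R≡crTable (n ∸ i)) ⟨
    + (k C i) * + R (n ∸ i)
      ≡⟨ pos-* (k C i) (R (n ∸ i)) ⟨
    + ((k C i) Data.Nat.* R (n ∸ i)) ∎

CR-via-Cat : ∀ n k → k ≤ n → + CR n k ≡ Σℤ (n ∸ k) (λ i → sgn i * + ((n ∸ k) C i) * + Cat (n ∸ i))
CR-via-Cat n k k≤n = begin
  + CR n k
    ≡⟨ cong +_ (CR≡crTable n k) ⟩
  + crTable k (n ∸ k)
    ≡⟨ crTable-column k (n ∸ k) ⟩
  Σℤ (n ∸ k) (λ i → sgn i * + ((n ∸ k) C i) * + crTable (k Data.Nat.+ (n ∸ k) ∸ i) 0)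
    ≡⟨ Σℤ-cong (n ∸ k) (λ i _ → cong (λ c → sgn i * + ((n ∸ k) C i) * + c) (term i)) ⟩
  Σℤ (n ∸ k) (λ i → sgn i * + ((n ∸ k) C i) * + Cat (n ∸ i)) ∎
  where
  term : ∀ i → crTable (k Data.Nat.+ (n ∸ k) ∸ i) 0 ≡ Cat (n ∸ i)
  term i = trans (cong (λ j → crTable (j ∸ i) 0) (m+[n∸m]≡n k≤n)) (sym (Cat≡crTable (n ∸ i)))

Cat-via-R : ∀ n → Cat n ≡ Σℕ n (λ i → (n C i) Data.Nat.* R i)
Cat-via-R n = +-injective (begin
  + Cat n
    ≡⟨ cong +_ (Cat≡crTable n) ⟩
  + crTable n 0
    ≡⟨ crTable-row n 0 ⟩
  Σℤ n (λ i → + (n C i) * + crTable 0 (n Data.Nat.+ 0 ∸ i))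
    ≡⟨ Σℤ-reverse n (λ i → + (n C i) * + crTable 0 (n Data.Nat.+ 0 ∸ i)) ⟩
  Σℤ n (λ i → + (n C (n ∸ i)) * + crTable 0 (n Data.Nat.+ 0 ∸ (n ∸ i)))
    ≡⟨ Σℤ-cong n (λ i i≤n → term i i≤n) ⟩
  Σℤ n (λ i → + ((n C i) Data.Nat.* R i))
    ≡⟨ Σℕ-as-Σℤ n (λ i → (n C i) Data.Nat.* R i) ⟨
  + Σℕ n (λ i → (n C i) Data.Nat.* R i) ∎)
  where
  term : ∀ i → i ≤ n →
         + (n C (n ∸ i)) * + crTable 0 (n Data.Nat.+ 0 ∸ (n ∸ i)) ≡ + ((n C i) Data.Nat.* R i)
  term i i≤n = begin
    + (n C (n ∸ i)) * + crTable 0 (n Data.Nat.+ 0 ∸ (n ∸ i))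
      ≡⟨ cong (λ j → + (n C (n ∸ i)) * + crTable 0 (j ∸ (n ∸ i))) (+-identityʳ n) ⟩
    + (n C (n ∸ i)) * + crTable 0 (n ∸ (n ∸ i))
      ≡⟨ cong₂ (λ c j → + c * + crTable 0 j) (nCk≡nC[n∸k] i≤n) (sym (m∸[m∸n]≡n i≤n)) ⟨
    + (n C i) * + crTable 0 i
      ≡⟨ cong (λ r → + (n C i) * + r) (R≡crTable i) ⟨
    + (n C i) * + R i
      ≡⟨ pos-* (n C i) (R i) ⟨
    + ((n C i) Data.Nat.* R i) ∎

R-via-Cat : ∀ n → + R n ≡ Σℤ n (λ i → sgn i * + (n C i) * + Cat (n ∸ i))
R-via-Cat n = begin
  + R n
    ≡⟨ cong +_ (R≡crTable n) ⟩
  + crTable 0 n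
    ≡⟨ crTable-column 0 n ⟩
  Σℤ n (λ i → sgn i * + (n C i) * + crTable (n ∸ i) 0)
    ≡⟨ Σℤ-cong n (λ i _ → cong (λ c → sgn i * + (n C i) * + c) (Cat≡crTable (n ∸ i))) ⟨
  Σℤ n (λ i → sgn i * + (n C i) * + Cat (n ∸ i)) ∎

corollary3p5 : ((n k : ℕ) → k ≤ n →
    (CR n k ≡ Σℕ k (λ i → (k C i) Data.Nat.* R (n ∸ i)))
    × (+ CR n k ≡ Σℤ (n ∸ k) (λ i → sgn i * + ((n ∸ k) C i) * + Cat (n ∸ i))))
    × ((n : ℕ) →
    (Cat n ≡ Σℕ n (λ i → (n C i) Data.Nat.* R i))
    × (+ R n ≡ Σℤ n (λ i → sgn i * + (n C i) * + Cat (n ∸ i))))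
corollary3p5 = (λ n k k≤n → CR-via-R n k k≤n , CR-via-Cat n k k≤n) , (λ n → Cat-via-R n , R-via-Cat n)
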